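{- Every set \(\Gamma\) of atomic sentences over a signature \(\Delta = (\Sigma^{n}, \Sigma^{r} \subseteq \Sigma)\) of hybrid-dynamic first-order logic with user-defined sharing admits a reachable initial model \((W^{\Gamma}, M^{\Gamma})\), i.e. a reachable \(\Delta\)-model satisfying \(\Gamma\) with exactly one \(\Delta\)-homomorphism into every \(\Delta\)-model satisfying \(\Gamma\).
   Context: Signatures: \(\Delta = (\Sigma^{n}, \Sigma^{r} \subseteq \Sigma)\), where \(\Sigma^{n} = (\{\star\}, F^{n}, P^{n})\) is a one-sorted first-order signature of nominals and \(\Sigma^{r} = (S^{r},F^{r},P^{r}) \subseteq \Sigma = (S,F,P)\) are many-sorted first-order signatures; symbols in \(\Sigma^{r}\) are rigid, the others (\(F^{f}, P^{f}\)) flexible. A \(\Delta\)-model is \((W,M)\) with \(W\) a \(\Sigma^{n}\)-model, \(|W|\) the carrier of \(\star\) (worlds), and \(M=\{M_w\}_{w\in|W|}\) \(\Sigma\)-models interpreting all rigid symbols identically. A \(\Delta\)-homomorphism \((W,M)\to(W',M')\) is a \(\Sigma^{n}\)-homomorphism \(h\colon W\to W'\) with \(\Sigma\)-homomorphisms \(h_w\colon M_w\to M'_{h(w)}\) coinciding on rigid sorts. Hybrid terms: the standard hybrid-term family \(\{T^{\Delta}_k\}_{k}\), indexed by ground nominal terms \(k \in T_{\Sigma^n}\), is the least family of \(S\)-sorted sets with \(\sigma(t)\in T^{\Delta}_{k,s}\) for rigid \(\sigma\in F^{r}_{ar\to s}\), \(\sigma(k,t)\in T^{\Delta}_{k,s}\)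 for flexible \(\sigma\in F^{f}_{ar\to s}\) (\(t\in T^{\Delta}_{k,ar}\)), and \(T^{\Delta}_{k_0,s} \subseteq T^{\Delta}_{k,s}\) for rigid sorts \(s\). In a \(\Delta\)-model \((W,M)\), \(W_k\) is the value of \(k\) and \((W,M)_t \in M_{W_k}\) the value of \(t \in T^{\Delta}_k\) (rigid \(\sigma\) evaluated by \(M_{W_k,\sigma}\), flexible \(\sigma(k',\cdot)\) by \(M_{W_{k'},\sigma}\)); equivalently via the unique homomorphism from the standard hybrid-term model. A \(\Delta\)-model is reachable if every world is some \(W_k\) and every element of every \(M_{W_k}\) is some \((W,M)_t\) with \(t \in T^{\Delta}_k\). Atomic sentences and their satisfaction (independent of the world of evaluation): nominal equation \(k_1 = k_2\): \(W_{k_1} = W_{k_2}\); nominal relation \(\lambda(k)\) (\(\lambda \in P^{n}\)): \(W_k \in W_\lambda\); hybrid equation \(t_1 =_{k} t_2\) (\(t_i \in T^{\Delta}_{k,s}\)): \((W,M)_{t_1} = (W,M)_{t_2}\); rigid relation \(\varpi(t)\) (\(\varpi \in P^{r}_{ar}\), \(t \in T^{\Delta}_{k,ar}\)): \((W,M)_t \in M_{w,\varpi}\) (the same for all \(w\)); flexible relation \(\pi(k,t)\) (\(\pi \in P^{f}_{ar}\), \(t \in T^{\Delta}_{k,ar}\)): \((W,M)_t \in M_{W_k,\pi}\). A model satisfies a set of sentences iff it satisfies each at every world. -}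

module Defs where

open import Data.Nat using (ℕ)
open import Data.Fin using (Fin)
open import Data.Sum using (_⊎_; inj₁; inj₂)
open import Data.Product using (Σ; _×_; proj₁)
open import Relation.Binary.Structures using (IsEquivalence)

record Sig : Set₁ where
  field
    Fn    : ℕ → Set
    Pn    : ℕ → Set
    RSort : Set
    FSort : Set
    ROp   : {n : ℕ} → (Fin n → RSort) → RSort → Set
    FOp   : {n : ℕ} → (Fin n → RSort ⊎ FSort) → RSort ⊎ FSort → Set
    RPred : {n : ℕ} → (Fin n → RSort) → Set
    FPred : {n : ℕ} → (Fin n → RSort ⊎ FSort) → Set

module _ (Δ : Sig) where
  open Sig Δ

  Sort : Set
  Sort = RSort ⊎ FSort

  data NTerm : Set where
    nop : {n : ℕ} → Fn n → (Fin n → NTerm) → NTerm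

  -- Hybrid terms.  T^Δ_{k,s} is  Tm (ix k s):  terms of a rigid sort s
  -- are shared by all k (they form T^Δ_{k,s} for every k), terms of a
  -- flexible sort are indexed by k.

  data Idx : Set where
    rig : RSort → Idx
    flx : NTerm → FSort → Idx

  ix : NTerm → Sort → Idx
  ix k (inj₁ s) = rig s
  ix k (inj₂ s) = flx k s

  data Tm : Idx → Set where
    rop  : {n : ℕ} {ar : Fin n → RSort} {s : RSort} →
           ROp ar s → ((i : Fin n) → Tm (rig (ar i))) → Tm (rig s)
    fopR : {n : ℕ} {ar : Fin n → Sort} {s : RSort} (k : NTerm) →
           FOp ar (inj₁ s) → ((i : Fin n) → Tm (ix k (ar i))) → Tm (rig s)
    fopF : {n : ℕ} {ar : Fin n → Sort} {s : FSort} (k : NTerm) →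
           FOp ar (inj₂ s) → ((i : Fin n) → Tm (ix k (ar i))) → Tm (flx k s)

  data Atom : Set where
    neq  : NTerm → NTerm → Atom
    nrel : {n : ℕ} → Pn n → (Fin n → NTerm) → Atom
    heq  : (k : NTerm) (s : Sort) → Tm (ix k s) → Tm (ix k s) → Atom
    -- ϖ(t)   (t of rigid sorts, hence in T^Δ_k for every k)
    rrel : {n : ℕ} {ar : Fin n → RSort} →
           RPred ar → ((i : Fin n) → Tm (rig (ar i))) → Atom
    frel : {n : ℕ} {ar : Fin n → Sort} → FPred ar → (k : NTerm) →
           ((i : Fin n) → Tm (ix k (ar i))) → Atom

  -- Rigid sorts have ONE carrier R s,
  -- shared by all M_w.  Flexible sorts are given as a family over worlds
  -- in total form: E s with a projection wd to worlds, the carrier of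
  -- M_w at s being the fibre {a ∈ E s ∣ wd a ≈ w}.

  record Carriers : Set₁ where
    field
      W      : Set
      _≈W_   : W → W → Set
      ≈W-eq  : IsEquivalence _≈W_
      R      : RSort → Set
      _≈R_   : {s : RSort} → R s → R s → Set
      ≈R-eq  : {s : RSort} → IsEquivalence (_≈R_ {s})
      E      : FSort → Set
      _≈E_   : {s : FSort} → E s → E s → Set
      ≈E-eq  : {s : FSort} → IsEquivalence (_≈E_ {s})
      wd     : {s : FSort} → E s → W
      wd-cong : {s : FSort} {a b : E s} → a ≈E b → wd a ≈W wd b

    Car : W → Sort → Set
    Car w (inj₁ s) = R s
    Car w (inj₂ s) = Σ (E s) (λ a → wd a ≈W w)

    HEq : (s : Sort) (w w' : W) → Car w s → Car w' s → Set
    HEq (inj₁ s) w w' a b = a ≈R b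
    HEq (inj₂ s) w w' a b = proj₁ a ≈E proj₁ b

  record Model : Set₁ where
    field
      C : Carriers
    open Carriers C public
    field
      nopM      : {n : ℕ} → Fn n → (Fin n → W) → W
      nopM-cong : {n : ℕ} (f : Fn n) {x y : Fin n → W} →
                  ((i : Fin n) → x i ≈W y i) → nopM f x ≈W nopM f y
      nrelM     : {n : ℕ} → Pn n → (Fin n → W) → Set
      nrelM-cong : {n : ℕ} (p : Pn n) {x y : Fin n → W} →
                  ((i : Fin n) → x i ≈W y i) → nrelM p x → nrelM p y
      -- rigid symbols: interpreted identically in every M_w
      ropM      : {n : ℕ} {ar : Fin n → RSort} {s : RSort} →
                  ROp ar s → ((i : Fin n) → R (ar i)) → R s
      ropM-cong : {n : ℕ} {ar : Fin n → RSort} {s : RSort} (σ : ROp ar s)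
                  {x y : (i : Fin n) → R (ar i)} →
                  ((i : Fin n) → x i ≈R y i) → ropM σ x ≈R ropM σ y
      rrelM     : {n : ℕ} {ar : Fin n → RSort} →
                  RPred ar → ((i : Fin n) → R (ar i)) → Set
      rrelM-cong : {n : ℕ} {ar : Fin n → RSort} (ϖ : RPred ar)
                  {x y : (i : Fin n) → R (ar i)} →
                  ((i : Fin n) → x i ≈R y i) → rrelM ϖ x → rrelM ϖ y
      fopM      : {n : ℕ} {ar : Fin n → Sort} {s : Sort} →
                  FOp ar s → (w : W) → ((i : Fin n) → Car w (ar i)) → Car w s
      fopM-cong : {n : ℕ} {ar : Fin n → Sort} {s : Sort} (σ : FOp ar s)
                  {w w' : W} {x : (i : Fin n) → Car w (ar i)}
                  {y : (i : Fin n) → Car w' (ar i)} → w ≈W w' →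
                  ((i : Fin n) → HEq (ar i) w w' (x i) (y i)) →
                  HEq s w w' (fopM σ w x) (fopM σ w' y)
      frelM     : {n : ℕ} {ar : Fin n → Sort} →
                  FPred ar → (w : W) → ((i : Fin n) → Car w (ar i)) → Set
      frelM-cong : {n : ℕ} {ar : Fin n → Sort} (π : FPred ar)
                  {w w' : W} {x : (i : Fin n) → Car w (ar i)}
                  {y : (i : Fin n) → Car w' (ar i)} → w ≈W w' →
                  ((i : Fin n) → HEq (ar i) w w' (x i) (y i)) →
                  frelM π w x → frelM π w' y

    ⟦_⟧ : NTerm → W
    ⟦ nop f k ⟧ = nopM f (λ i → ⟦ k i ⟧)

    IdxCar : Idx → Set
    IdxCar (rig s)   = R s
    IdxCar (flx k s) = Car ⟦ k ⟧ (inj₂ s)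

    toCar : (k : NTerm) (s : Sort) → IdxCar (ix k s) → Car ⟦ k ⟧ s
    toCar k (inj₁ s) a = a
    toCar k (inj₂ s) a = a

    eval : {i : Idx} → Tm i → IdxCar i
    eval (rop σ t) = ropM σ (λ i → eval (t i))
    eval (fopR {ar = ar} k σ t) = fopM σ ⟦ k ⟧ (λ i → toCar k (ar i) (eval (t i)))
    eval (fopF {ar = ar} k σ t) = fopM σ ⟦ k ⟧ (λ i → toCar k (ar i) (eval (t i)))

    val : (k : NTerm) (s : Sort) → Tm (ix k s) → Car ⟦ k ⟧ s
    val k s t = toCar k s (eval t)

    -- satisfaction of atomic sentences (independent of the world)
    Sat : Atom → Set
    Sat (neq k₁ k₂)    = ⟦ k₁ ⟧ ≈W ⟦ k₂ ⟧
    Sat (nrel p k)     = nrelM p (λ i → ⟦ k i ⟧)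
    Sat (heq k s t₁ t₂) = HEq s ⟦ k ⟧ ⟦ k ⟧ (val k s t₁) (val k s t₂)
    Sat (rrel ϖ t)     = rrelM ϖ (λ i → eval (t i))
    Sat (frel {ar = ar} π k t) = frelM π ⟦ k ⟧ (λ i → val k (ar i) (t i))

    Satisfies : (Atom → Set) → Set
    Satisfies Γ = (w : W) (φ : Atom) → Γ φ → Sat φ

    Reachable : Set
    Reachable =
      ((w : W) → Σ NTerm (λ k → w ≈W ⟦ k ⟧)) ×
      ((k : NTerm) (s : Sort) (a : Car ⟦ k ⟧ s) →
         Σ (Tm (ix k s)) (λ t → HEq s ⟦ k ⟧ ⟦ k ⟧ (val k s t) a))

  record Hom (M N : Model) : Set where
    private
      module M = Model M
      module N = Model N
    field
      hW       : M.W → N.W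
      hW-cong  : {w w' : M.W} → w M.≈W w' → hW w N.≈W hW w'
      hW-nop   : {n : ℕ} (f : Fn n) (x : Fin n → M.W) →
                 hW (M.nopM f x) N.≈W N.nopM f (λ i → hW (x i))
      hW-nrel  : {n : ℕ} (p : Pn n) (x : Fin n → M.W) →
                 M.nrelM p x → N.nrelM p (λ i → hW (x i))
      h        : (w : M.W) (s : Sort) → M.Car w s → N.Car (hW w) s
      h-cong   : (s : Sort) {w w' : M.W} {a : M.Car w s} {b : M.Car w' s} →
                 w M.≈W w' → M.HEq s w w' a b →
                 N.HEq s (hW w) (hW w') (h w s a) (h w' s b)
      h-rigid  : (w w' : M.W) (s : RSort) (a : M.R s) →
                 h w (inj₁ s) a N.≈R h w' (inj₁ s) a
      h-rop    : (w : M.W) {n : ℕ} {ar : Fin n → RSort} {s : RSort}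
                 (σ : ROp ar s) (x : (i : Fin n) → M.R (ar i)) →
                 h w (inj₁ s) (M.ropM σ x) N.≈R
                 N.ropM σ (λ i → h w (inj₁ (ar i)) (x i))
      h-fop    : (w : M.W) {n : ℕ} {ar : Fin n → Sort} {s : Sort}
                 (σ : FOp ar s) (x : (i : Fin n) → M.Car w (ar i)) →
                 N.HEq s (hW w) (hW w) (h w s (M.fopM σ w x))
                   (N.fopM σ (hW w) (λ i → h w (ar i) (x i)))
      h-rrel   : (w : M.W) {n : ℕ} {ar : Fin n → RSort}
                 (ϖ : RPred ar) (x : (i : Fin n) → M.R (ar i)) →
                 M.rrelM ϖ x → N.rrelM ϖ (λ i → h w (inj₁ (ar i)) (x i))
      h-frel   : (w : M.W) {n : ℕ} {ar : Fin n → Sort}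
                 (π : FPred ar) (x : (i : Fin n) → M.Car w (ar i)) →
                 M.frelM π w x → N.frelM π (hW w) (λ i → h w (ar i) (x i))

  HomEq : {M N : Model} → Hom M N → Hom M N → Set
  HomEq {M} {N} f g =
    ((w : Model.W M) → Model._≈W_ N (Hom.hW f w) (Hom.hW g w)) ×
    ((w : Model.W M) (s : Sort) (a : Model.Car M w s) →
       Model.HEq N s (Hom.hW f w) (Hom.hW g w) (Hom.h f w s a) (Hom.h g w s a))

{-# OPTIONS --safe #-}
module Submission where

open import Data.Fin using (Fin)
open import Data.Nat using (ℕ)
open import Data.Product using (Σ; _×_; _,_; proj₁; proj₂)
open import Data.Sum using (inj₁; inj₂)
open import Relation.Binary.Structures using (IsEquivalence)

open import Defs

-- The initial model is the term model: its worlds are the ground nominal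
-- terms and its elements the hybrid terms, both taken modulo the least
-- congruence generated by the equations of Γ, and a relation holds of a
-- tuple exactly when Γ asserts it of a congruent tuple.  Every term
-- evaluates to itself there, which gives satisfaction of Γ and
-- reachability.  Any model of Γ validates that congruence, so evaluation of
-- terms is a homomorphism out of the term model; and since a homomorphism
-- commutes with all operations, induction on terms shows that every
-- homomorphism agrees with evaluation.

module TermModel (Δ : Sig) (Γ : Atom Δ → Set) where
  open Sig Δ

  private
    NT : Set
    NT = NTerm Δ

  infix 4 _≈ₙ_ _≈ʳ_ _≈ᶠ_

  data _≈ₙ_ : NT → NT → Set where
    ≈ₙ-refl  : ∀ {k} → k ≈ₙ k
    ≈ₙ-sym   : ∀ {k k′} → k ≈ₙ k′ → k′ ≈ₙ k
    ≈ₙ-trans : ∀ {k k′ k″} → k ≈ₙ k′ → k′ ≈ₙ k″ → k ≈ₙ k″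
    ≈ₙ-nop   : ∀ {n} (f : Fn n) {x y : Fin n → NT} →
               (∀ i → x i ≈ₙ y i) → nop f x ≈ₙ nop f y
    ≈ₙ-ax    : ∀ {k k′} → Γ (neq k k′) → k ≈ₙ k′

  -- A flexible term is indexed by the world of its top symbol; moving it to
  -- another world k′ rewrites that index, and is meaningful for k ≈ₙ k′.
  mutual
    retagᶠ : ∀ {s k} k′ → Tm Δ (flx k s) → Tm Δ (flx k′ s)
    retagᶠ k′ (fopF {ar = ar} k σ x) = fopF k′ σ (λ i → retag k k′ (ar i) (x i))

    retag : (k k′ : NT) (a : Sort Δ) → Tm Δ (ix Δ k a) → Tm Δ (ix Δ k′ a)
    retag k k′ (inj₁ s) t = t
    retag k k′ (inj₂ s) t = retagᶠ k′ t

  -- Flexible terms of different worlds are compared, so that ≈ᶠ can serve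
  -- as the equality of the total flexible carrier of the term model.
  mutual
    data _≈ʳ_ : {s : RSort} → Tm Δ (rig s) → Tm Δ (rig s) → Set where
      ≈ʳ-refl  : ∀ {s} {t : Tm Δ (rig s)} → t ≈ʳ t
      ≈ʳ-sym   : ∀ {s} {t u : Tm Δ (rig s)} → t ≈ʳ u → u ≈ʳ t
      ≈ʳ-trans : ∀ {s} {t u v : Tm Δ (rig s)} → t ≈ʳ u → u ≈ʳ v → t ≈ʳ v
      ≈ʳ-rop   : ∀ {n} {ar : Fin n → RSort} {s} (σ : ROp ar s) {x y} →
                 (∀ i → x i ≈ʳ y i) → rop σ x ≈ʳ rop σ y
      ≈ʳ-fopR  : ∀ {n} {ar : Fin n → Sort Δ} {s} {k k′}
                 (σ : FOp ar (inj₁ s)) {x y} → k ≈ₙ k′ →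
                 (∀ i → TmEq k k′ (ar i) (x i) (y i)) → fopR k σ x ≈ʳ fopR k′ σ y
      ≈ʳ-ax    : ∀ {k s t u} → Γ (heq k (inj₁ s) t u) → t ≈ʳ u

    data _≈ᶠ_ : {s : FSort} {k k′ : NT} → Tm Δ (flx k s) → Tm Δ (flx k′ s) → Set where
      ≈ᶠ-refl  : ∀ {s k} {t : Tm Δ (flx k s)} → t ≈ᶠ t
      ≈ᶠ-sym   : ∀ {s k k′} {t : Tm Δ (flx k s)} {u : Tm Δ (flx k′ s)} →
                 t ≈ᶠ u → u ≈ᶠ t
      ≈ᶠ-trans : ∀ {s k k′ k″} {t : Tm Δ (flx k s)} {u : Tm Δ (flx k′ s)}
                 {v : Tm Δ (flx k″ s)} → t ≈ᶠ u → u ≈ᶠ v → t ≈ᶠ v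
      ≈ᶠ-fopF  : ∀ {n} {ar : Fin n → Sort Δ} {s} {k k′}
                 (σ : FOp ar (inj₂ s)) {x y} → k ≈ₙ k′ →
                 (∀ i → TmEq k k′ (ar i) (x i) (y i)) → fopF k σ x ≈ᶠ fopF k′ σ y
      ≈ᶠ-ax    : ∀ {k s t u} → Γ (heq k (inj₂ s) t u) → t ≈ᶠ u

    TmEq : (k k′ : NT) (a : Sort Δ) → Tm Δ (ix Δ k a) → Tm Δ (ix Δ k′ a) → Set
    TmEq k k′ (inj₁ s) = _≈ʳ_
    TmEq k k′ (inj₂ s) = _≈ᶠ_

  TmEq-sym : ∀ {k k′} a {t u} → TmEq k k′ a t u → TmEq k′ k a u t
  TmEq-sym (inj₁ s) = ≈ʳ-sym
  TmEq-sym (inj₂ s) = ≈ᶠ-sym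

  TmEq-trans : ∀ {k k′ k″} a {t u v} →
               TmEq k k′ a t u → TmEq k′ k″ a u v → TmEq k k″ a t v
  TmEq-trans (inj₁ s) = ≈ʳ-trans
  TmEq-trans (inj₂ s) = ≈ᶠ-trans

  ≈ᶠ⇒≈ₙ : ∀ {s k k′} {t : Tm Δ (flx k s)} {u : Tm Δ (flx k′ s)} → t ≈ᶠ u → k ≈ₙ k′
  ≈ᶠ⇒≈ₙ ≈ᶠ-refl          = ≈ₙ-refl
  ≈ᶠ⇒≈ₙ (≈ᶠ-sym p)       = ≈ₙ-sym (≈ᶠ⇒≈ₙ p)
  ≈ᶠ⇒≈ₙ (≈ᶠ-trans p q)   = ≈ₙ-trans (≈ᶠ⇒≈ₙ p) (≈ᶠ⇒≈ₙ q)
  ≈ᶠ⇒≈ₙ (≈ᶠ-fopF σ k≈ _) = k≈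
  ≈ᶠ⇒≈ₙ (≈ᶠ-ax _)        = ≈ₙ-refl

  mutual
    retagᶠ-≈ : ∀ {s k k′} → k ≈ₙ k′ → (t : Tm Δ (flx k s)) → t ≈ᶠ retagᶠ k′ t
    retagᶠ-≈ k≈ (fopF {ar = ar} k σ x) = ≈ᶠ-fopF σ k≈ (λ i → retag-≈ k≈ (ar i) (x i))

    retag-≈ : ∀ {k k′} → k ≈ₙ k′ → (a : Sort Δ) (t : Tm Δ (ix Δ k a)) →
              TmEq k k′ a t (retag k k′ a t)
    retag-≈ k≈ (inj₁ s) t = ≈ʳ-refl
    retag-≈ k≈ (inj₂ s) t = retagᶠ-≈ k≈ t

  carriers : Carriers Δ
  carriers = record
    { W      = NT
    ; _≈W_   = _≈ₙ_
    ; ≈W-eq  = record { refl = ≈ₙ-refl ; sym = ≈ₙ-sym ; trans = ≈ₙ-trans }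
    ; R      = λ s → Tm Δ (rig s)
    ; _≈R_   = _≈ʳ_
    ; ≈R-eq  = record { refl = ≈ʳ-refl ; sym = ≈ʳ-sym ; trans = ≈ʳ-trans }
    ; E      = λ s → Σ NT (λ k → Tm Δ (flx k s))
    ; _≈E_   = λ a b → proj₂ a ≈ᶠ proj₂ b
    ; ≈E-eq  = record { refl = ≈ᶠ-refl ; sym = ≈ᶠ-sym ; trans = ≈ᶠ-trans }
    ; wd     = proj₁
    ; wd-cong = ≈ᶠ⇒≈ₙ
    }

  open Carriers carriers using (Car; HEq)

  asTerm : (w : NT) (a : Sort Δ) → Car w a → Tm Δ (ix Δ w a)
  asTerm w (inj₁ s) t             = t
  asTerm w (inj₂ s) ((k , t) , _) = retagᶠ w t

  asTerm-cong : ∀ {w w′} a {x : Car w a} {y : Car w′ a} → w ≈ₙ w′ → HEq a w w′ x y →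
                TmEq w w′ a (asTerm w a x) (asTerm w′ a y)
  asTerm-cong (inj₁ s) _ x≈y = x≈y
  asTerm-cong (inj₂ s) {(_ , t) , k≈w} {(_ , u) , k′≈w′} _ x≈y =
    ≈ᶠ-trans (≈ᶠ-sym (retagᶠ-≈ k≈w t)) (≈ᶠ-trans x≈y (retagᶠ-≈ k′≈w′ u))

  fopᵀ : ∀ {n} {ar : Fin n → Sort Δ} {a : Sort Δ} →
         FOp ar a → (w : NT) → ((i : Fin n) → Car w (ar i)) → Car w a
  fopᵀ {ar = ar} {inj₁ s} σ w x = fopR w σ (λ i → asTerm w (ar i) (x i))
  fopᵀ {ar = ar} {inj₂ s} σ w x = (w , fopF w σ (λ i → asTerm w (ar i) (x i))) , ≈ₙ-refl

  fopᵀ-cong : ∀ {n} {ar : Fin n → Sort Δ} {a : Sort Δ} (σ : FOp ar a)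
              {w w′ : NT} {x : (i : Fin n) → Car w (ar i)}
              {y : (i : Fin n) → Car w′ (ar i)} → w ≈ₙ w′ →
              ((i : Fin n) → HEq (ar i) w w′ (x i) (y i)) →
              HEq a w w′ (fopᵀ σ w x) (fopᵀ σ w′ y)
  fopᵀ-cong {ar = ar} {inj₁ s} σ w≈ x≈y = ≈ʳ-fopR σ w≈ (λ i → asTerm-cong (ar i) w≈ (x≈y i))
  fopᵀ-cong {ar = ar} {inj₂ s} σ w≈ x≈y = ≈ᶠ-fopF σ w≈ (λ i → asTerm-cong (ar i) w≈ (x≈y i))

  -- Satisfaction quantifies over worlds, so transporting a nominal relation
  -- of Γ into another model needs a world to evaluate it at; hence the
  -- witness world stored with it.
  NRel : ∀ {n} → Pn n → (Fin n → NT) → Set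
  NRel {n} p x = NT × Σ (Fin n → NT) (λ y → Γ (nrel p y) × (∀ i → y i ≈ₙ x i))

  RRel : ∀ {n} {ar : Fin n → RSort} → RPred ar → ((i : Fin n) → Tm Δ (rig (ar i))) → Set
  RRel {n} {ar} ϖ x =
    Σ ((i : Fin n) → Tm Δ (rig (ar i))) (λ y → Γ (rrel ϖ y) × (∀ i → y i ≈ʳ x i))

  FRel : ∀ {n} {ar : Fin n → Sort Δ} → FPred ar → (w : NT) → ((i : Fin n) → Car w (ar i)) → Set
  FRel {n} {ar} π w x =
    Σ NT λ k → Σ ((i : Fin n) → Tm Δ (ix Δ k (ar i))) λ y →
      Γ (frel π k y) × k ≈ₙ w × (∀ i → TmEq k w (ar i) (y i) (asTerm w (ar i) (x i)))

  I : Model Δ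
  I = record
    { C          = carriers
    ; nopM       = nop
    ; nopM-cong  = ≈ₙ-nop
    ; nrelM      = NRel
    ; nrelM-cong = λ p x≈y (k₀ , z , γ , z≈x) → k₀ , z , γ , (λ i → ≈ₙ-trans (z≈x i) (x≈y i))
    ; ropM       = rop
    ; ropM-cong  = ≈ʳ-rop
    ; rrelM      = RRel
    ; rrelM-cong = λ ϖ x≈y (z , γ , z≈x) → z , γ , (λ i → ≈ʳ-trans (z≈x i) (x≈y i))
    ; fopM       = fopᵀ
    ; fopM-cong  = fopᵀ-cong
    ; frelM      = FRel
    ; frelM-cong = λ {_} {ar} π w≈ x≈y (k , z , γ , k≈w , z≈x) →
        k , z , γ , ≈ₙ-trans k≈w w≈ ,
        (λ i → TmEq-trans (ar i) (z≈x i) (asTerm-cong (ar i) w≈ (x≈y i)))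
    }

  module I = Model I

  ⟦⟧-≈ₙ : ∀ k → I.⟦ k ⟧ ≈ₙ k
  ⟦⟧-≈ₙ (nop f x) = ≈ₙ-nop f (λ i → ⟦⟧-≈ₙ (x i))

  mutual
    eval-≈ʳ : ∀ {s} (t : Tm Δ (rig s)) → I.eval t ≈ʳ t
    eval-≈ʳ (rop σ x)               = ≈ʳ-rop σ (λ i → eval-≈ʳ (x i))
    eval-≈ʳ (fopR {ar = ar} k σ x) = ≈ʳ-fopR σ (⟦⟧-≈ₙ k) (λ i → val-≈ k (ar i) (x i))

    eval-≈ᶠ : ∀ {s k} (t : Tm Δ (flx k s)) → proj₂ (proj₁ (I.eval t)) ≈ᶠ t
    eval-≈ᶠ (fopF {ar = ar} k σ x) = ≈ᶠ-fopF σ (⟦⟧-≈ₙ k) (λ i → val-≈ k (ar i) (x i))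

    val-≈ : ∀ k a (t : Tm Δ (ix Δ k a)) → TmEq I.⟦ k ⟧ k a (asTerm I.⟦ k ⟧ a (I.val k a t)) t
    val-≈ k (inj₁ s) t = eval-≈ʳ t
    val-≈ k (inj₂ s) t = ≈ᶠ-trans (≈ᶠ-sym (retagᶠ-≈ (proj₂ (I.eval t)) _)) (eval-≈ᶠ t)

  I-satisfies : I.Satisfies Γ
  I-satisfies w (neq k₁ k₂) γ =
    ≈ₙ-trans (⟦⟧-≈ₙ k₁) (≈ₙ-trans (≈ₙ-ax γ) (≈ₙ-sym (⟦⟧-≈ₙ k₂)))
  I-satisfies w (nrel p k) γ = w , k , γ , (λ i → ≈ₙ-sym (⟦⟧-≈ₙ (k i)))
  I-satisfies w (heq k (inj₁ s) t u) γ =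
    ≈ʳ-trans (eval-≈ʳ t) (≈ʳ-trans (≈ʳ-ax γ) (≈ʳ-sym (eval-≈ʳ u)))
  I-satisfies w (heq k (inj₂ s) t u) γ =
    ≈ᶠ-trans (eval-≈ᶠ t) (≈ᶠ-trans (≈ᶠ-ax γ) (≈ᶠ-sym (eval-≈ᶠ u)))
  I-satisfies w (rrel ϖ t) γ = t , γ , (λ i → ≈ʳ-sym (eval-≈ʳ (t i)))
  I-satisfies w (frel {ar = ar} π k t) γ =
    k , t , γ , ≈ₙ-sym (⟦⟧-≈ₙ k) , (λ i → TmEq-sym (ar i) (val-≈ k (ar i) (t i)))

  I-reachable : I.Reachable
  I-reachable = (λ w → w , ≈ₙ-sym (⟦⟧-≈ₙ w)) , reach
    where
    reach : (k : NT) (a : Sort Δ) (x : I.Car I.⟦ k ⟧ a) →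
            Σ (Tm Δ (ix Δ k a)) (λ t → I.HEq a I.⟦ k ⟧ I.⟦ k ⟧ (I.val k a t) x)
    reach k (inj₁ s) t = t , eval-≈ʳ t
    reach k (inj₂ s) ((_ , t) , k′≈) =
      retagᶠ k t , ≈ᶠ-trans (eval-≈ᶠ _) (≈ᶠ-sym (retagᶠ-≈ (≈ₙ-trans k′≈ (⟦⟧-≈ₙ k)) t))

module Initiality (Δ : Sig) (Γ : Atom Δ → Set) (N : Model Δ) (N⊨Γ : Model.Satisfies N Γ) where
  open Sig Δ
  open TermModel Δ Γ

  private
    module N = Model N
    module NW = IsEquivalence N.≈W-eq
    module NR {s} = IsEquivalence (N.≈R-eq {s})
    module NE {s} = IsEquivalence (N.≈E-eq {s})

  HEq-trans : ∀ a {w w′ w″ x y z} → N.HEq a w w′ x y → N.HEq a w′ w″ y z → N.HEq a w w″ x z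
  HEq-trans (inj₁ s) = NR.trans
  HEq-trans (inj₂ s) = NE.trans

  ≈ₙ-sound : ∀ {k k′} → k ≈ₙ k′ → N.⟦ k ⟧ N.≈W N.⟦ k′ ⟧
  ≈ₙ-sound ≈ₙ-refl         = NW.refl
  ≈ₙ-sound (≈ₙ-sym p)      = NW.sym (≈ₙ-sound p)
  ≈ₙ-sound (≈ₙ-trans p q)  = NW.trans (≈ₙ-sound p) (≈ₙ-sound q)
  ≈ₙ-sound (≈ₙ-nop f p)    = N.nopM-cong f (λ i → ≈ₙ-sound (p i))
  ≈ₙ-sound (≈ₙ-ax {k} γ)   = N⊨Γ N.⟦ k ⟧ _ γ

  mutual
    ≈ʳ-sound : ∀ {s} {t u : Tm Δ (rig s)} → t ≈ʳ u → N.eval t N.≈R N.eval u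
    ≈ʳ-sound ≈ʳ-refl                  = NR.refl
    ≈ʳ-sound (≈ʳ-sym p)               = NR.sym (≈ʳ-sound p)
    ≈ʳ-sound (≈ʳ-trans p q)           = NR.trans (≈ʳ-sound p) (≈ʳ-sound q)
    ≈ʳ-sound (≈ʳ-rop σ p)             = N.ropM-cong σ (λ i → ≈ʳ-sound (p i))
    ≈ʳ-sound (≈ʳ-fopR {ar = ar} σ k≈ p) =
      N.fopM-cong σ (≈ₙ-sound k≈) (λ i → TmEq-sound (ar i) (p i))
    ≈ʳ-sound (≈ʳ-ax {k} γ)            = N⊨Γ N.⟦ k ⟧ _ γ

    ≈ᶠ-sound : ∀ {s k k′} {t : Tm Δ (flx k s)} {u : Tm Δ (flx k′ s)} →
               t ≈ᶠ u → proj₁ (N.eval t) N.≈E proj₁ (N.eval u)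
    ≈ᶠ-sound ≈ᶠ-refl                  = NE.refl
    ≈ᶠ-sound (≈ᶠ-sym p)               = NE.sym (≈ᶠ-sound p)
    ≈ᶠ-sound (≈ᶠ-trans p q)           = NE.trans (≈ᶠ-sound p) (≈ᶠ-sound q)
    ≈ᶠ-sound (≈ᶠ-fopF {ar = ar} σ k≈ p) =
      N.fopM-cong σ (≈ₙ-sound k≈) (λ i → TmEq-sound (ar i) (p i))
    ≈ᶠ-sound (≈ᶠ-ax {k} γ)            = N⊨Γ N.⟦ k ⟧ _ γ

    TmEq-sound : ∀ {k k′} a {t u} → TmEq k k′ a t u →
                 N.HEq a N.⟦ k ⟧ N.⟦ k′ ⟧ (N.val k a t) (N.val k′ a u)
    TmEq-sound (inj₁ s) = ≈ʳ-sound
    TmEq-sound (inj₂ s) = ≈ᶠ-sound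

  evalᴺ : (w : NTerm Δ) (a : Sort Δ) → I.Car w a → N.Car N.⟦ w ⟧ a
  evalᴺ w (inj₁ s) t             = N.eval t
  evalᴺ w (inj₂ s) ((_ , t) , k≈w) =
    proj₁ (N.eval t) , NW.trans (proj₂ (N.eval t)) (≈ₙ-sound k≈w)

  val-asTerm : (w : NTerm Δ) (a : Sort Δ) (x : I.Car w a) →
               N.HEq a N.⟦ w ⟧ N.⟦ w ⟧ (N.val w a (asTerm w a x)) (evalᴺ w a x)
  val-asTerm w (inj₁ s) x                = NR.refl
  val-asTerm w (inj₂ s) ((_ , t) , k≈w) = ≈ᶠ-sound (≈ᶠ-sym (retagᶠ-≈ k≈w t))

  evalᴺ-fop : (w : NTerm Δ) {n : ℕ} {ar : Fin n → Sort Δ} {a : Sort Δ}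
              (σ : FOp ar a) (x : (i : Fin n) → I.Car w (ar i)) →
              N.HEq a N.⟦ w ⟧ N.⟦ w ⟧ (evalᴺ w a (I.fopM σ w x))
                (N.fopM σ N.⟦ w ⟧ (λ i → evalᴺ w (ar i) (x i)))
  evalᴺ-fop w {ar = ar} {inj₁ s} σ x = N.fopM-cong σ NW.refl (λ i → val-asTerm w (ar i) (x i))
  evalᴺ-fop w {ar = ar} {inj₂ s} σ x = N.fopM-cong σ NW.refl (λ i → val-asTerm w (ar i) (x i))

  evalHom : Hom Δ I N
  evalHom = record
    { hW      = N.⟦_⟧
    ; hW-cong = ≈ₙ-sound
    ; hW-nop  = λ _ _ → NW.refl
    ; hW-nrel = λ p x (k₀ , y , γ , y≈x) →
        N.nrelM-cong p (λ i → ≈ₙ-sound (y≈x i)) (N⊨Γ N.⟦ k₀ ⟧ (nrel p y) γ)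
    ; h       = evalᴺ
    ; h-cong  = λ { (inj₁ s) _ p → ≈ʳ-sound p ; (inj₂ s) _ p → ≈ᶠ-sound p }
    ; h-rigid = λ _ _ _ _ → NR.refl
    ; h-rop   = λ _ _ _ → NR.refl
    ; h-fop   = evalᴺ-fop
    ; h-rrel  = λ w ϖ x (y , γ , y≈x) →
        N.rrelM-cong ϖ (λ i → ≈ʳ-sound (y≈x i)) (N⊨Γ N.⟦ w ⟧ (rrel ϖ y) γ)
    ; h-frel  = λ w {_} {ar} π x (k , y , γ , k≈w , y≈x) →
        N.frelM-cong π (≈ₙ-sound k≈w)
          (λ i → HEq-trans (ar i) (TmEq-sound (ar i) (y≈x i)) (val-asTerm w (ar i) (x i)))
          (N⊨Γ N.⟦ k ⟧ _ γ)
    }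

  embed : (k : NTerm Δ) (a : Sort Δ) → Tm Δ (ix Δ k a) → I.Car k a
  embed k (inj₁ s) t = t
  embed k (inj₂ s) t = (k , t) , ≈ₙ-refl

  asTerm-embed : (k : NTerm Δ) (a : Sort Δ) (t : Tm Δ (ix Δ k a)) →
                 TmEq k k a t (asTerm k a (embed k a t))
  asTerm-embed k (inj₁ s) t = ≈ʳ-refl
  asTerm-embed k (inj₂ s) t = retagᶠ-≈ ≈ₙ-refl t

  module _ (g : Hom Δ I N) where
    private
      module g = Hom g

    hW≈⟦⟧ : ∀ k → g.hW k N.≈W N.⟦ k ⟧
    hW≈⟦⟧ (nop f x) = NW.trans (g.hW-nop f x) (N.nopM-cong f (λ i → hW≈⟦⟧ (x i)))

    -- A term whose top symbol is flexible at world k is, in the term model,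
    -- that symbol applied at world k to its embedded arguments, so g sends
    -- it to the symbol applied in N to the images of the arguments.
    mutual
      h≈evalʳ : ∀ {s} (w : NTerm Δ) (t : Tm Δ (rig s)) → g.h w (inj₁ s) t N.≈R N.eval t
      h≈evalʳ w (rop σ x) = NR.trans (g.h-rop w σ x) (N.ropM-cong σ (λ i → h≈evalʳ w (x i)))
      h≈evalʳ {s} w (fopR {ar = ar} k σ x) =
        NR.trans (g.h-rigid w k s (fopR k σ x))
          (NR.trans (g.h-cong (inj₁ s) ≈ₙ-refl
                      (≈ʳ-fopR σ ≈ₙ-refl (λ i → asTerm-embed k (ar i) (x i))))
            (NR.trans (g.h-fop k σ (λ i → embed k (ar i) (x i)))
              (N.fopM-cong σ (hW≈⟦⟧ k) (λ i → h≈val k (ar i) (x i)))))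

      h≈evalᶠ : ∀ {s k} (t : Tm Δ (flx k s)) →
                proj₁ (g.h k (inj₂ s) (embed k (inj₂ s) t)) N.≈E proj₁ (N.eval t)
      h≈evalᶠ {s} (fopF {ar = ar} k σ x) =
        NE.trans (g.h-cong (inj₂ s) ≈ₙ-refl
                   (≈ᶠ-fopF σ ≈ₙ-refl (λ i → asTerm-embed k (ar i) (x i))))
          (NE.trans (g.h-fop k σ (λ i → embed k (ar i) (x i)))
            (N.fopM-cong σ (hW≈⟦⟧ k) (λ i → h≈val k (ar i) (x i))))

      h≈val : ∀ k a (t : Tm Δ (ix Δ k a)) →
              N.HEq a (g.hW k) N.⟦ k ⟧ (g.h k a (embed k a t)) (N.val k a t)
      h≈val k (inj₁ s) t = h≈evalʳ k t
      h≈val k (inj₂ s) t = h≈evalᶠ t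

    evalHom-unique : HomEq Δ evalHom g
    evalHom-unique = (λ w → NW.sym (hW≈⟦⟧ w)) , evalᴺ≈h
      where
      evalᴺ≈h : (w : NTerm Δ) (a : Sort Δ) (x : I.Car w a) →
                N.HEq a N.⟦ w ⟧ (g.hW w) (evalᴺ w a x) (g.h w a x)
      evalᴺ≈h w (inj₁ s) t = NR.sym (h≈evalʳ w t)
      evalᴺ≈h w (inj₂ s) ((_ , t) , k≈w) =
        NE.sym (NE.trans (g.h-cong (inj₂ s) (≈ₙ-sym k≈w) ≈ᶠ-refl) (h≈evalᶠ t))

theorem11 : (Δ : Sig) (Γ : Atom Δ → Set) →
    Σ (Model Δ) (λ I →
      Model.Reachable I ×
      Model.Satisfies I Γ ×
      ((M : Model Δ) → Model.Satisfies M Γ →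
        Σ (Hom Δ I M) (λ f → (g : Hom Δ I M) → HomEq Δ f g)))
theorem11 Δ Γ =
  I , I-reachable , I-satisfies ,
  λ N N⊨Γ → evalHom N N⊨Γ , evalHom-unique N N⊨Γ
  where
  open TermModel Δ Γ
  open Initiality Δ Γ
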